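{- Let $K$ be a complete graph whose edges are colored with colors from $[5]$, and let $X$ be a set of five vertices of $K$ such that no monochromatic component of color $4$ and no monochromatic component of color $5$ contains two vertices of $X$. For $i\in[3]$, let $(n^i_1,\dots,n^i_{t_i})$ (with $n^i_1\ge\dots\ge n^i_{t_i}\ge 1$) be the list of the sizes $|V(C)\cap X|$ over all components $C$ of color $i$ with $V(C)\cap X\neq\emptyset$ (so $\sum_m n^i_m=5$). Suppose there are distinct $i,j,k\in[3]$ such that (i) $t_i+t_j+|\{m: n^k_m\geq 3\}|\leq 4$, or (ii) $t_i+|\{m: n^j_m\geq 2\}|+|\{m:n^k_m\geq 2\}|\leq 4$. Then there exist at most four monochromatic components of $K$, each of a color in $[3]$, whose vertex sets together cover $V(K)$.
   Context: A component of color $i$ is a connected component of the spanning subgraph of $K$ formed by all edges of color $i$ (a vertex incident with no edge of color $i$ forms a trivial component of color $i$). -}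

module Defs where

open import Data.Nat using (ℕ; _≤_; _≤?_)
open import Data.Fin using (Fin; _↑ˡ_; #_)
open import Data.Fin.Properties using () renaming (_≟_ to _≟ᶠ_)
open import Data.List using (List; length; filter; allFin)
open import Data.Product using (_×_)
open import Relation.Binary.PropositionalEquality using (_≡_; _≢_)
open import Relation.Binary.Construct.Closure.ReflexiveTransitive using (Star)

-- Colors [5] are Fin 5: color m (1-based) is index m-1.
-- An edge-coloring of the complete graph on vertex set Fin n with colors [5]:
-- a symmetric function on pairs (values on the diagonal are irrelevant).
record Coloring (n : ℕ) : Set where
  field
    col : Fin n → Fin n → Fin 5
    sym : ∀ u v → col u v ≡ col v u
open Coloring public

Adj : ∀ {n} → Coloring n → Fin 5 → Fin n → Fin n → Set
Adj K a u v = (u ≢ v) × (col K u v ≡ a)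

Conn : ∀ {n} → Coloring n → Fin 5 → Fin n → Fin n → Set
Conn K a = Star (Adj K a)

c3 : Fin 3 → Fin 5
c3 i = i ↑ˡ 2

color4 color5 : Fin 5
color4 = # 3
color5 = # 4

-- Given a labelling f : Fin 5 → Fin 5 of the points of X whose fibres are exactly
-- the traces V(C) ∩ X of the components C of a color meeting X:
-- size f l = number of points of X with label l
size : (Fin 5 → Fin 5) → Fin 5 → ℕ
size f l = length (filter (λ p → f p ≟ᶠ l) (allFin 5))

classesAtLeast : ℕ → (Fin 5 → Fin 5) → ℕ
classesAtLeast s f = length (filter (λ l → s ≤? size f l) (allFin 5))

-- A vertex of X lies in its own component of color i.  A vertex v outside X
-- sends five edges to X, and at most two of them have color 4 or 5, since a
-- component of color 4 or 5 meets X at most once.  Points of X joined to v by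
-- edges of one color lie, with v, in a single component of that color.  So if
-- no edge at v has color i (nor j, in case (i)), at least three edges have
-- color k, or (case (ii)) at least two have color j or two have color k, and v
-- lies in a listed component whose trace on X is that large.

{-# OPTIONS --safe #-}
module Submission where

open import Defs renaming (sym to col-sym)
open import Data.Nat using (ℕ; suc; _+_; _≤_; _<_; z≤n; s≤s; _≤?_)
open import Data.Nat.Properties
  using (≤-trans; ≤-refl; +-monoʳ-≤; +-mono-≤; +-cancelʳ-≤; +-suc; n≤1+n; ≤-reflexive; module ≤-Reasoning)
open import Data.Fin using (Fin; zero)
open import Data.Fin.Properties using (any?; all?; _≟_)
open import Data.List using (List; []; _∷_; length; filter; allFin; map; _++_)
open import Data.List.Properties using (length-map; length-++; filter-all; filter-some)
open import Data.List.Relation.Unary.Any using (Any)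
import Data.List.Relation.Unary.Any as Any
open import Data.List.Relation.Unary.Any.Properties using (map⁺; ++⁺ˡ; ++⁺ʳ)
open import Data.List.Relation.Unary.All as All using (All; []; _∷_)
open import Data.List.Relation.Unary.All.Properties using (all-filter)
open import Data.List.Relation.Unary.AllPairs using ([]; _∷_)
open import Data.List.Relation.Unary.Unique.Propositional using (Unique)
import Data.List.Relation.Unary.Unique.Propositional.Properties as Unique
open import Data.List.Relation.Binary.Sublist.Propositional.Properties
  using (length-mono-≤) renaming (filter⁺ to filter-sublist⁺)
open import Data.List.Relation.Binary.Sublist.Propositional using () renaming (⊆-refl to sublist-refl)
open import Data.List.Membership.Propositional.Properties using (∈-filter⁺; ∈-allFin)
open import Data.Empty using (⊥-elim)
open import Data.Product using (_×_; _,_; Σ; ∃; proj₁; proj₂)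
open import Data.Sum using (_⊎_; inj₁; inj₂; [_,_])
import Data.Sum as Sum
open import Function using (_∘_)
open import Function.Bundles using (_⇔_; module Equivalence)
open import Level using (0ℓ)
open import Relation.Nullary using (¬_; yes; no)
open import Relation.Nullary.Decidable using (_⊎-dec_; _→-dec_; ¬?; toWitness)
open import Relation.Unary using (Pred; Decidable; _⊆_; _∪_)
open import Relation.Unary.Properties using (_∪?_)
open import Relation.Binary.PropositionalEquality
  using (_≡_; _≢_; refl; sym; trans; cong; cong₂; subst; module ≡-Reasoning)
open import Relation.Binary.Construct.Closure.ReflexiveTransitive using (ε; _◅_; _◅◅_)

module _ {A : Set} {P Q : Pred A 0ℓ} (P? : Decidable P) (Q? : Decidable Q) where

  length-filter-mono : P ⊆ Q → ∀ xs → length (filter P? xs) ≤ length (filter Q? xs)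
  length-filter-mono P⊆Q xs =
    length-mono-≤ (filter-sublist⁺ P? Q? (λ { refl → P⊆Q }) (sublist-refl {x = xs}))

  length-filter-∪ : ∀ xs →
                    length (filter (P? ∪? Q?) xs) ≤ length (filter P? xs) + length (filter Q? xs)
  length-filter-∪ [] = z≤n
  length-filter-∪ (a ∷ xs) with ih ← length-filter-∪ xs | P? a | Q? a
  ... | yes _ | yes _ = s≤s (≤-trans ih (+-monoʳ-≤ _ (n≤1+n _)))
  ... | yes _ | no _  = s≤s ih
  ... | no _  | yes _ = ≤-trans (s≤s ih) (≤-reflexive (sym (+-suc _ _)))
  ... | no _  | no _  = ih

module _ {A : Set} {P : Pred A 0ℓ} (P? : Decidable P) where

  length-filter≤1 : (∀ {a b} → P a → P b → a ≡ b) → ∀ {xs} → Unique xs →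
                    length (filter P? xs) ≤ 1
  length-filter≤1 P-unique {xs} xs! = go (Unique.filter⁺ P? xs!) (all-filter P? xs)
    where
    go : ∀ {ys} → Unique ys → All P ys → length ys ≤ 1
    go [] _ = z≤n
    go (_ ∷ []) _ = s≤s z≤n
    go ((a≢b ∷ _) ∷ _) (pa ∷ pb ∷ _) = ⊥-elim (a≢b (P-unique pa pb))

  ∃-of-length-filter : ∀ xs → 0 < length (filter P? xs) → ∃ P
  ∃-of-length-filter xs pos with filter P? xs | all-filter P? xs
  ... | y ∷ _ | py ∷ _ = y , py

pigeonhole-1-1-3 : ∀ a b c → 5 ≤ a + (b + (c + 2)) → 1 ≤ a ⊎ 1 ≤ b ⊎ 3 ≤ c
pigeonhole-1-1-3 (suc _) _       _ _ = inj₁ (s≤s z≤n)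
pigeonhole-1-1-3 0       (suc _) _ _ = inj₂ (inj₁ (s≤s z≤n))
pigeonhole-1-1-3 0       0       c h = inj₂ (inj₂ (+-cancelʳ-≤ 2 3 c h))

pigeonhole-1-2-2 : ∀ a b c → 5 ≤ a + (b + (c + 2)) → 1 ≤ a ⊎ 2 ≤ b ⊎ 2 ≤ c
pigeonhole-1-2-2 (suc _) _             _ _       = inj₁ (s≤s z≤n)
pigeonhole-1-2-2 0       (suc (suc _)) _ _       = inj₂ (inj₁ (s≤s (s≤s z≤n)))
pigeonhole-1-2-2 0       1             c (s≤s h) = inj₂ (inj₂ (+-cancelʳ-≤ 2 2 c h))
pigeonhole-1-2-2 0       0             c h       = inj₂ (inj₂ (≤-trans (n≤1+n 2) (+-cancelʳ-≤ 2 3 c h)))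

color-among : ∀ (i j k : Fin 3) → i ≢ j → j ≢ k → i ≢ k → ∀ (a : Fin 5) →
               a ≡ c3 i ⊎ a ≡ c3 j ⊎ a ≡ c3 k ⊎ a ≡ color4 ⊎ a ≡ color5
color-among = toWitness {a? = all? λ i → all? λ j → all? λ k →
  ¬? (i ≟ j) →-dec ¬? (j ≟ k) →-dec ¬? (i ≟ k) →-dec all? λ a →
  (a ≟ c3 i) ⊎-dec (a ≟ c3 j) ⊎-dec (a ≟ c3 k) ⊎-dec (a ≟ color4) ⊎-dec (a ≟ color5)} _

count : {P : Pred (Fin 5) 0ℓ} → Decidable P → ℕ
count P? = length (filter P? (allFin 5))

pick : ∀ {m k} → (Fin (suc m) → Fin k) → Fin k → Fin (suc m)
pick g l with any? (λ p → g p ≟ l)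
... | yes (p , _) = p
... | no _        = zero

pick-preimage : ∀ {m k} (g : Fin (suc m) → Fin k) {l} p → g p ≡ l → g (pick g l) ≡ l
pick-preimage g {l} p gp≡l with any? (λ p → g p ≟ l)
... | yes (_ , gq≡l) = gq≡l
... | no ∄           = ⊥-elim (∄ (p , gp≡l))

module Covering {n} (K : Coloring n) (x : Fin 5 → Fin n) (f : Fin 3 → Fin 5 → Fin 5)
    (f-classes : ∀ i p q → (f i p ≡ f i q) ⇔ Conn K (c3 i) (x p) (x q)) where

  open Equivalence

  CoveredBy : List (Fin 3 × Fin n) → Fin n → Set
  CoveredBy cs v = Any (λ c → Conn K (c3 (proj₁ c)) (proj₂ c) v) cs

  components : ℕ → Fin 3 → List (Fin 3 × Fin n)
  components s m = map (λ l → m , x (pick (f m) l)) (filter (λ l → s ≤? size (f m) l) (allFin 5))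

  length-components : ∀ s m → length (components s m) ≡ classesAtLeast s (f m)
  length-components s m =
    length-map (λ l → m , x (pick (f m) l)) (filter (λ l → s ≤? size (f m) l) (allFin 5))

  components-cover : ∀ {s m p v} → s ≤ size (f m) (f m p) → Conn K (c3 m) (x p) v →
                     CoveredBy (components s m) v
  components-cover {s} {m} {p} large p~v =
    map⁺ (Any.map (λ { refl → pick~p ◅◅ p~v })
               (∈-filter⁺ (λ l → s ≤? size (f m) l) (∈-allFin (f m p)) large))
    where
    pick~p : Conn K (c3 m) (x (pick (f m) (f m p))) (x p)
    pick~p = to (f-classes m _ p) (pick-preimage (f m) p refl)

  class-size≥1 : ∀ m p → 1 ≤ size (f m) (f m p)
  class-size≥1 m p = filter-some (λ q → f m q ≟ f m p) (Any.map (λ { refl → refl }) (∈-allFin p))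

  family : ℕ → ℕ → ℕ → Fin 3 → Fin 3 → Fin 3 → List (Fin 3 × Fin n)
  family s t u i j k = (components s i ++ components t j) ++ components u k

  length-family : ∀ s t u i j k → length (family s t u i j k) ≡
                  classesAtLeast s (f i) + classesAtLeast t (f j) + classesAtLeast u (f k)
  length-family s t u i j k = begin
    length ((components s i ++ components t j) ++ components u k)
      ≡⟨ length-++ (components s i ++ components t j) ⟩
    length (components s i ++ components t j) + length (components u k)
      ≡⟨ cong (_+ length (components u k)) (length-++ (components s i)) ⟩
    length (components s i) + length (components t j) + length (components u k)
      ≡⟨ cong₂ _+_ (cong₂ _+_ (length-components s i) (length-components t j))
                   (length-components u k) ⟩
    classesAtLeast s (f i) + classesAtLeast t (f j) + classesAtLeast u (f k) ∎
    where open ≡-Reasoning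

  family-covers : ∀ {t u i j k} v →
                  (((p : Fin 5) → x p ≢ v) →
                    CoveredBy (components 1 i) v ⊎ CoveredBy (components t j) v ⊎
                    CoveredBy (components u k) v) →
                  CoveredBy (family 1 t u i j k) v
  family-covers {t} {u} {i} {j} {k} v outside with any? (λ p → x p ≟ v)
  ... | yes (p , refl) = ++⁺ˡ (++⁺ˡ (components-cover (class-size≥1 i p) ε))
  ... | no ∄           =
    [ ++⁺ˡ ∘ ++⁺ˡ
    , [ ++⁺ˡ ∘ ++⁺ʳ (components 1 i) , ++⁺ʳ (components 1 i ++ components t j) ] ]
      (outside λ p xp≡v → ∄ (p , xp≡v))

  Separating : Fin 5 → Set
  Separating a = ∀ p q → p ≢ q → ¬ Conn K a (x p) (x q)

  module Outside (v : Fin n) (v∉X : ∀ p → x p ≢ v) where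

    color : Fin 5 → Fin 5
    color p = col K (x p) v

    Colored : Fin 5 → Pred (Fin 5) 0ℓ
    Colored a p = color p ≡ a

    colored? : ∀ a → Decidable (Colored a)
    colored? a p = color p ≟ a

    #colored : Fin 5 → ℕ
    #colored a = count (colored? a)

    edge : ∀ {a p} → color p ≡ a → Conn K a (x p) v
    edge {p = p} refl = (v∉X p , refl) ◅ ε

    via-v : ∀ {a p q} → color p ≡ a → color q ≡ a → Conn K a (x p) (x q)
    via-v {q = q} p~a q~a = edge p~a ◅◅ ((v∉X q ∘ sym , trans (col-sym K v (x q)) q~a) ◅ ε)

    #colored≤1 : ∀ {a} → Separating a → #colored a ≤ 1
    #colored≤1 {a} separated = length-filter≤1 (colored? a) same (Unique.allFin⁺ 5)
      where
      same : ∀ {p q} → color p ≡ a → color q ≡ a → p ≡ q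
      same {p} {q} p~a q~a with p ≟ q
      ... | yes p≡q = p≡q
      ... | no p≢q  = ⊥-elim (separated p q p≢q (via-v p~a q~a))

    covered-if-many : ∀ {s m} → 1 ≤ s → s ≤ #colored (c3 m) → CoveredBy (components s m) v
    covered-if-many {s} {m} 1≤s many
      with ∃-of-length-filter (colored? (c3 m)) (allFin 5) (≤-trans 1≤s many)
    ... | p , p~m = components-cover (≤-trans many class⊇color) (edge p~m)
      where
      class⊇color : #colored (c3 m) ≤ size (f m) (f m p)
      class⊇color = length-filter-mono (colored? (c3 m)) (λ q → f m q ≟ f m p)
                       (λ q~m → from (f-classes m _ p) (via-v q~m p~m)) (allFin 5)

    five≤#colored : ∀ {i j k} → i ≢ j → j ≢ k → i ≢ k →
                    Separating color4 → Separating color5 →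
                    5 ≤ #colored (c3 i) + (#colored (c3 j) + (#colored (c3 k) + 2))
    five≤#colored {i} {j} {k} i≢j j≢k i≢k sep4 sep5 = begin
      5
        ≡⟨ cong length (sym (filter-all ijk45? every-point-counted)) ⟩
      count ijk45?
        ≤⟨ length-filter-∪ (colored? (c3 i)) jk45? (allFin 5) ⟩
      #i + count jk45?
        ≤⟨ +-monoʳ-≤ #i (length-filter-∪ (colored? (c3 j)) k45? (allFin 5)) ⟩
      #i + (#j + count k45?)
        ≤⟨ +-monoʳ-≤ #i (+-monoʳ-≤ #j (length-filter-∪ (colored? (c3 k)) c45? (allFin 5))) ⟩
      #i + (#j + (#k + count c45?))
        ≤⟨ +-monoʳ-≤ #i (+-monoʳ-≤ #j (+-monoʳ-≤ #k colored45≤2)) ⟩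
      #i + (#j + (#k + 2)) ∎
      where
      open ≤-Reasoning
      #i #j #k : ℕ
      #i = #colored (c3 i)
      #j = #colored (c3 j)
      #k = #colored (c3 k)
      Colored45 Coloredk45 Coloredjk45 Coloredijk45 : Pred (Fin 5) 0ℓ
      Colored45    = Colored color4 ∪ Colored color5
      Coloredk45   = Colored (c3 k) ∪ Colored45
      Coloredjk45  = Colored (c3 j) ∪ Coloredk45
      Coloredijk45 = Colored (c3 i) ∪ Coloredjk45
      c45? : Decidable Colored45
      c45? = colored? color4 ∪? colored? color5
      k45? : Decidable Coloredk45
      k45? = colored? (c3 k) ∪? c45?
      jk45? : Decidable Coloredjk45
      jk45? = colored? (c3 j) ∪? k45?
      ijk45? : Decidable Coloredijk45
      ijk45? = colored? (c3 i) ∪? jk45?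
      every-point-counted : All Coloredijk45 (allFin 5)
      every-point-counted = All.universal (color-among i j k i≢j j≢k i≢k ∘ color) (allFin 5)
      colored45≤2 : count c45? ≤ 2
      colored45≤2 = ≤-trans (length-filter-∪ (colored? color4) (colored? color5) (allFin 5))
                            (+-mono-≤ (#colored≤1 sep4) (#colored≤1 sep5))

  family-covers-all : ∀ {t u i j k} → i ≢ j → j ≢ k → i ≢ k →
                      Separating color4 → Separating color5 →
                      1 ≤ t → 1 ≤ u → (∀ a b c → 5 ≤ a + (b + (c + 2)) → 1 ≤ a ⊎ t ≤ b ⊎ u ≤ c) →
                      ∀ v → CoveredBy (family 1 t u i j k) v
  family-covers-all {t} {u} {i} {j} {k} i≢j j≢k i≢k sep4 sep5 1≤t 1≤u split v =
    family-covers {t} {u} {i} {j} {k} v λ v∉X → let open Outside v v∉X in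
      Sum.map (covered-if-many ≤-refl) (Sum.map (covered-if-many 1≤t) (covered-if-many 1≤u))
        (split _ _ _ (five≤#colored i≢j j≢k i≢k sep4 sep5))

lemma3p5 : (n : ℕ) (K : Coloring n) (x : Fin 5 → Fin n)
    → (∀ p q → x p ≡ x q → p ≡ q)
    → (∀ p q → p ≢ q → ¬ Conn K color4 (x p) (x q))
    → (∀ p q → p ≢ q → ¬ Conn K color5 (x p) (x q))
    → (f : Fin 3 → Fin 5 → Fin 5)
    → (∀ i p q → (f i p ≡ f i q) ⇔ Conn K (c3 i) (x p) (x q))
    → Σ (Fin 3) (λ i → Σ (Fin 3) (λ j → Σ (Fin 3) (λ k →
        (i ≢ j) × (j ≢ k) × (i ≢ k) ×
        ((classesAtLeast 1 (f i) + classesAtLeast 1 (f j) + classesAtLeast 3 (f k) ≤ 4)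
         ⊎ (classesAtLeast 1 (f i) + classesAtLeast 2 (f j) + classesAtLeast 2 (f k) ≤ 4)))))
    → Σ (List (Fin 3 × Fin n)) (λ cs → (length cs ≤ 4) ×
        (∀ v → Any (λ c → Conn K (c3 (proj₁ c)) (proj₂ c) v) cs))
lemma3p5 n K x _ sep4 sep5 f f-classes (i , j , k , i≢j , j≢k , i≢k , inj₁ bound) =
  family 1 1 3 i j k , subst (_≤ 4) (sym (length-family 1 1 3 i j k)) bound ,
  family-covers-all i≢j j≢k i≢k sep4 sep5 (s≤s z≤n) (s≤s z≤n) pigeonhole-1-1-3
  where open Covering K x f f-classes
lemma3p5 n K x _ sep4 sep5 f f-classes (i , j , k , i≢j , j≢k , i≢k , inj₂ bound) =
  family 1 2 2 i j k , subst (_≤ 4) (sym (length-family 1 2 2 i j k)) bound ,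
  family-covers-all i≢j j≢k i≢k sep4 sep5 (s≤s z≤n) (s≤s z≤n) pigeonhole-1-2-2
  where open Covering K x f f-classes
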